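{- There is an absolute constant $C>0$ such that the following holds. Let $n\ge 1$ and $r\ge 1$ be integers, let $c_1 < c_2 < \dots < c_r$ be elements of $[n]=\{1,\dots,n\}$, and let $k \in [n]$. If $m_1, m_2, \dots, m_r$ are integers such that $$m_1c_1 + m_2c_2 + \dots + m_rc_r = k,$$ then there exist integers $m'_1, m'_2, \dots, m'_r$ satisfying $$m'_1c_1 + m'_2c_2 + \dots + m'_rc_r = k$$ such that $|m'_1|+|m'_2|+\dots+|m'_r| \leq C\, n r$.
   Context: $[n]$ denotes $\{1,2,\dots,n\}$. The bound $O(nr)$ in the paper is interpreted as $\le C nr$ for a constant $C$ independent of $n,r,c_i,k,m_i$. -}

module Defs where

open import Data.Nat using (ℕ; zero; suc)
open import Data.Fin using (Fin)
import Data.Fin as Fin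
open import Data.Integer using (ℤ; +_; _*_; _+_; ∣_∣)
import Data.Nat as ℕ

sumℤ : ∀ {r} → (Fin r → ℤ) → ℤ
sumℤ {zero}  f = + 0
sumℤ {suc r} f = f Fin.zero + sumℤ (λ i → f (Fin.suc i))

sumℕ : ∀ {r} → (Fin r → ℕ) → ℕ
sumℕ {zero}  f = 0
sumℕ {suc r} f = f Fin.zero ℕ.+ sumℕ (λ i → f (Fin.suc i))

lincomb : ∀ {r} → (Fin r → ℤ) → (Fin r → ℕ) → ℤ
lincomb m c = sumℤ (λ i → m i * + (c i))

l1norm : ∀ {r} → (Fin r → ℤ) → ℕ
l1norm m = sumℕ (λ i → ∣ m i ∣)

-- Reduce every coefficient except the first modulo c₁ and absorb the quotients
-- into the first coefficient; this preserves the sum. The residues then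
-- contribute at most r c₁ ≤ r n to the ℓ¹-norm, while the new first
-- coefficient m′₁ satisfies m′₁ c₁ = k − S with 0 ≤ S ≤ r c₁ n, so
-- |m′₁| ≤ (k + S) / c₁ ≤ (r + 1) n. Hence C = 2 works.
module Submission where

open import Defs
open import Data.Nat using (ℕ; zero; suc; _≤_; _<_; _*_; NonZero; >-nonZero; z≤n; s≤s)
import Data.Nat as ℕ
import Data.Nat.Properties as ℕ
import Data.Nat.Tactic.RingSolver as ℕ-Solver
open import Data.Fin using (Fin)
import Data.Fin as Fin
open import Data.Integer using (ℤ; +_; -_; ∣_∣)
import Data.Integer as ℤ
import Data.Integer.Properties as ℤ
import Data.Integer.Tactic.RingSolver as ℤ-Solver
open import Data.Integer.DivMod using (_/ℕ_; _%ℕ_; n%ℕd<d; a≡a%ℕn+[a/ℕn]*n)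
open import Algebra.Properties.CommutativeSemigroup ℤ.+-commutativeSemigroup using (interchange)
open import Data.Vec.Functional using (_∷_)
open import Data.Product using (Σ; _×_; ∃; _,_; proj₁; proj₂)
open import Function using (_∘_)
open import Relation.Binary.PropositionalEquality

sumℤ-cong : ∀ {r} {f g : Fin r → ℤ} → (∀ i → f i ≡ g i) → sumℤ f ≡ sumℤ g
sumℤ-cong {zero}  f≗g = refl
sumℤ-cong {suc r} f≗g = cong₂ ℤ._+_ (f≗g Fin.zero) (sumℤ-cong (f≗g ∘ Fin.suc))

sumℤ-distrib-+ : ∀ {r} (f g : Fin r → ℤ) →
                 sumℤ (λ i → f i ℤ.+ g i) ≡ sumℤ f ℤ.+ sumℤ g
sumℤ-distrib-+ {zero}  f g = refl
sumℤ-distrib-+ {suc r} f g =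
  trans (cong (ℤ._+_ (f Fin.zero ℤ.+ g Fin.zero)) (sumℤ-distrib-+ (f ∘ Fin.suc) (g ∘ Fin.suc)))
        (interchange (f Fin.zero) (g Fin.zero) _ _)

sumℤ-distribʳ-* : ∀ {r} (f : Fin r → ℤ) x → sumℤ f ℤ.* x ≡ sumℤ (λ i → f i ℤ.* x)
sumℤ-distribʳ-* {zero}  f x = refl
sumℤ-distribʳ-* {suc r} f x =
  trans (ℤ.*-distribʳ-+ x (f Fin.zero) _)
        (cong (ℤ._+_ (f Fin.zero ℤ.* x)) (sumℤ-distribʳ-* (f ∘ Fin.suc) x))

sumℤ-pos : ∀ {r} (f : Fin r → ℕ) → sumℤ (λ i → + f i) ≡ + sumℕ f
sumℤ-pos {zero}  f = refl
sumℤ-pos {suc r} f = cong (ℤ._+_ (+ f Fin.zero)) (sumℤ-pos (f ∘ Fin.suc))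

sumℕ-mono-≤ : ∀ {r} {f g : Fin r → ℕ} → (∀ i → f i ≤ g i) → sumℕ f ≤ sumℕ g
sumℕ-mono-≤ {zero}  f≤g = z≤n
sumℕ-mono-≤ {suc r} f≤g = ℕ.+-mono-≤ (f≤g Fin.zero) (sumℕ-mono-≤ (f≤g ∘ Fin.suc))

sumℕ-const : ∀ r a → sumℕ {r} (λ _ → a) ≡ r * a
sumℕ-const zero    a = refl
sumℕ-const (suc r) a = cong (a ℕ.+_) (sumℕ-const r a)

sumℕ-≤-const : ∀ {r} {f : Fin r → ℕ} {a} → (∀ i → f i ≤ a) → sumℕ f ≤ r * a
sumℕ-≤-const {r} {a = a} f≤a = ℕ.≤-trans (sumℕ-mono-≤ f≤a) (ℕ.≤-reflexive (sumℕ-const r a))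

lincomb-pos : ∀ {r} (t c : Fin r → ℕ) → lincomb (λ i → + t i) c ≡ + sumℕ (λ i → t i * c i)
lincomb-pos t c =
  trans (sumℤ-cong (λ i → sym (ℤ.pos-* (t i) (c i)))) (sumℤ-pos (λ i → t i * c i))

lincomb-divMod : ∀ {r} d .{{_ : NonZero d}} (m : Fin r → ℤ) (c : Fin r → ℕ) →
                 lincomb m c ≡ lincomb (λ i → + (m i %ℕ d)) c
                               ℤ.+ sumℤ (λ i → m i /ℕ d ℤ.* + c i) ℤ.* + d
lincomb-divMod d m c = begin
  sumℤ (λ i → m i ℤ.* + c i)
    ≡⟨ sumℤ-cong (λ i → termwise (m i) (+ c i)) ⟩
  sumℤ (λ i → res i ℤ.* + c i ℤ.+ quo i ℤ.* + c i ℤ.* + d)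
    ≡⟨ sumℤ-distrib-+ (λ i → res i ℤ.* + c i) (λ i → quo i ℤ.* + c i ℤ.* + d) ⟩
  lincomb res c ℤ.+ sumℤ (λ i → quo i ℤ.* + c i ℤ.* + d)
    ≡⟨ cong (ℤ._+_ (lincomb res c)) (sumℤ-distribʳ-* (λ i → quo i ℤ.* + c i) (+ d)) ⟨
  lincomb res c ℤ.+ sumℤ (λ i → quo i ℤ.* + c i) ℤ.* + d ∎
  where
  open ≡-Reasoning
  res quo : Fin _ → ℤ
  res i = + (m i %ℕ d)
  quo i = m i /ℕ d
  distribute : ∀ t q x y → (t ℤ.+ q ℤ.* y) ℤ.* x ≡ t ℤ.* x ℤ.+ q ℤ.* x ℤ.* y
  distribute = ℤ-Solver.solve-∀
  termwise : ∀ a x → a ℤ.* x ≡ + (a %ℕ d) ℤ.* x ℤ.+ a /ℕ d ℤ.* x ℤ.* + d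
  termwise a x = trans (cong (ℤ._* x) (a≡a%ℕn+[a/ℕn]*n a d))
                       (distribute (+ (a %ℕ d)) (a /ℕ d) x (+ d))

∣x∣*d≤k+s : ∀ x d k s → x ℤ.* + d ℤ.+ + s ≡ + k → ∣ x ∣ * d ≤ k ℕ.+ s
∣x∣*d≤k+s x d k s eq = begin
  ∣ x ∣ * d             ≡⟨ ℤ.abs-* x (+ d) ⟨
  ∣ x ℤ.* + d ∣         ≡⟨ cong ∣_∣ (trans (isolate (x ℤ.* + d) (+ s)) (cong (ℤ._- + s) eq)) ⟩
  ∣ + k ℤ.+ - (+ s) ∣   ≤⟨ ℤ.∣i+j∣≤∣i∣+∣j∣ (+ k) (- (+ s)) ⟩
  k ℕ.+ ∣ - (+ s) ∣     ≡⟨ cong (k ℕ.+_) (ℤ.∣-i∣≡∣i∣ (+ s)) ⟩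
  k ℕ.+ s               ∎
  where
  open ℕ.≤-Reasoning
  isolate : ∀ y z → y ≡ y ℤ.+ z ℤ.- z
  isolate = ℤ-Solver.solve-∀

reduceTail : ∀ {r} d .{{_ : NonZero d}} (c : Fin r → ℕ) (m₀ : ℤ) (m : Fin r → ℤ) → Fin (suc r) → ℤ
reduceTail d c m₀ m = (m₀ ℤ.+ sumℤ (λ i → m i /ℕ d ℤ.* + c i)) ∷ (λ i → + (m i %ℕ d))

lincomb-reduceTail : ∀ {r} d .{{_ : NonZero d}} (c : Fin r → ℕ) m₀ m →
                     lincomb (reduceTail d c m₀ m) (d ∷ c) ≡ lincomb (m₀ ∷ m) (d ∷ c)
lincomb-reduceTail d c m₀ m =
  trans (regroup m₀ _ (+ d) _) (cong (ℤ._+_ (m₀ ℤ.* + d)) (sym (lincomb-divMod d m c)))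
  where
  regroup : ∀ a q x t → (a ℤ.+ q) ℤ.* x ℤ.+ t ≡ a ℤ.* x ℤ.+ (t ℤ.+ q ℤ.* x)
  regroup = ℤ-Solver.solve-∀

l1norm-reduceTail : ∀ n {r} d .{{_ : NonZero d}} (c : Fin r → ℕ) m₀ m {k} →
                    d ≤ n → (∀ i → c i ≤ n) → k ≤ n → lincomb (m₀ ∷ m) (d ∷ c) ≡ + k →
                    l1norm (reduceTail d c m₀ m) ≤ 2 * n * suc r
l1norm-reduceTail n {r} d c m₀ m {k} d≤n c≤n k≤n eq = begin
  ∣ m₀′ ∣ ℕ.+ sumℕ t     ≤⟨ ℕ.+-mono-≤ first-bound residues-bound ⟩
  suc r * n ℕ.+ suc r * n ≡⟨ double n r ⟩
  2 * n * suc r          ∎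
  where
  open ℕ.≤-Reasoning
  t : Fin r → ℕ
  t i = m i %ℕ d
  m₀′ : ℤ
  m₀′ = m₀ ℤ.+ sumℤ (λ i → m i /ℕ d ℤ.* + c i)
  S : ℕ
  S = sumℕ (λ i → t i * c i)
  t<d : ∀ i → t i < d
  t<d i = n%ℕd<d (m i) d
  residues-bound : sumℕ t ≤ suc r * n
  residues-bound = ℕ.≤-trans (sumℕ-≤-const (ℕ.<⇒≤ ∘ t<d))
                             (ℕ.≤-trans (ℕ.*-monoʳ-≤ r d≤n) (ℕ.m≤n+m (r * n) n))
  S≤r*d*n : S ≤ r * (d * n)
  S≤r*d*n = sumℕ-≤-const (λ i → ℕ.*-mono-≤ (ℕ.<⇒≤ (t<d i)) (c≤n i))
  m₀′*d+S≡k : m₀′ ℤ.* + d ℤ.+ + S ≡ + k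
  m₀′*d+S≡k = trans (cong (ℤ._+_ (m₀′ ℤ.* + d)) (sym (lincomb-pos t c)))
                    (trans (lincomb-reduceTail d c m₀ m) eq)
  collect : ∀ n d r → n * d ℕ.+ r * (d * n) ≡ suc r * n * d
  collect = ℕ-Solver.solve-∀
  double : ∀ n r → suc r * n ℕ.+ suc r * n ≡ 2 * n * suc r
  double = ℕ-Solver.solve-∀
  first-bound : ∣ m₀′ ∣ ≤ suc r * n
  first-bound = ℕ.*-cancelʳ-≤ ∣ m₀′ ∣ (suc r * n) d (begin
    ∣ m₀′ ∣ * d              ≤⟨ ∣x∣*d≤k+s m₀′ d k S m₀′*d+S≡k ⟩
    k ℕ.+ S                  ≤⟨ ℕ.+-mono-≤ (ℕ.≤-trans k≤n (ℕ.m≤m*n n d)) S≤r*d*n ⟩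
    n * d ℕ.+ r * (d * n)    ≡⟨ collect n d r ⟩
    suc r * n * d            ∎)

short-representation : ∀ n {r} (c : Fin (suc r) → ℕ) → 1 ≤ c Fin.zero → (∀ i → c i ≤ n) →
                       ∀ {k} → k ≤ n → (m : Fin (suc r) → ℤ) → lincomb m c ≡ + k →
                       ∃ λ (m′ : Fin (suc r) → ℤ) → lincomb m′ c ≡ + k × l1norm m′ ≤ 2 * n * suc r
short-representation n c 1≤c₀ c≤n k≤n m eq =
  reduceTail c₀ (c ∘ Fin.suc) (m Fin.zero) (m ∘ Fin.suc) ,
  trans (lincomb-reduceTail c₀ (c ∘ Fin.suc) (m Fin.zero) (m ∘ Fin.suc)) eq ,
  l1norm-reduceTail n c₀ (c ∘ Fin.suc) (m Fin.zero) (m ∘ Fin.suc) (c≤n Fin.zero) (c≤n ∘ Fin.suc) k≤n eq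
  where
  c₀ : ℕ
  c₀ = c Fin.zero
  instance
    c₀-nonZero : NonZero c₀
    c₀-nonZero = >-nonZero 1≤c₀

lemma1 : Σ ℕ λ C → (0 < C) ×
           ((n r : ℕ) → 1 ≤ n → 1 ≤ r →
            (c : Fin r → ℕ) →
            (∀ (i j : Fin r) → i Fin.< j → c i < c j) →
            (∀ (i : Fin r) → 1 ≤ c i × c i ≤ n) →
            (k : ℕ) → 1 ≤ k → k ≤ n →
            (m : Fin r → ℤ) → lincomb m c ≡ + k →
            ∃ λ (m′ : Fin r → ℤ) →
              (lincomb m′ c ≡ + k) × (l1norm m′ ≤ C * n * r))
lemma1 = 2 , s≤s z≤n , λ where
  n zero    _ ()
  n (suc r) _ _ c _ c-bounds k _ k≤n m eq →
    short-representation n c (proj₁ (c-bounds Fin.zero)) (proj₂ ∘ c-bounds) k≤n m eq
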